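{- An oriented matroid $\mathcal M$ on $\binom{[n]}{2}$ is a sweep oriented matroid if and only if for every covector $X$ of $\mathcal M$ and every $1\le i<j<k\le n$, the triple $(X_{(i,j)},X_{(j,k)},X_{(i,k)})$ is orthogonal to the sign vector $(+,+,-)$. Equivalently, if and only if for every covector $X$ and $1\le i<j<k\le n$, the triple $(X_{(i,j)},X_{(j,k)},X_{(i,k)})$ is not one of $(+,+,-)$, $(-,-,+)$, $(0,+,-)$, $(0,-,+)$, $(+,0,-)$, $(-,0,+)$, $(+,+,0)$, $(-,-,0)$, $(0,0,-)$, $(0,0,+)$, $(0,+,0)$, $(0,-,0)$, $(+,0,0)$, $(-,0,0)$.
   Context: Oriented matroids are given by covectors satisfying the standard covector axioms. Two sign vectors are orthogonal if their supports (sets of nonzero entries) are disjoint, or their restrictions to the intersection of supports are neither equal nor opposite. $\binom{[n]}{2}$ is the set of pairs $(i,j)$, $1\le i<j\le n$. For an ordered partition $I$ of $[n]$ with block-index map $p_I$ ($p_I(i)=k$ iff $i$ is in the $k$-th block), $X^I_{(i,j)}=+,-,0$ according as $p_I(i)<,>,=p_I(j)$. The braid oriented matroid $\mathcal A_n$ on $\binom{[n]}{2}$ has covectors exactly the $X^I$ (it is the oriented matroid of the vectors $e_j-e_i$). A sweep oriented matroid is an oriented matroid on $\binom{[n]}{2}$ every covector of which is a covector of $\mathcal A_n$. -}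

module Defs where

open import Data.Nat using (ℕ; suc)
open import Data.Fin using (Fin; zero; suc; _<_)
open import Data.Fin.Properties using (<-trans)
open import Data.Product using (Σ; ∃; ∃-syntax; _×_; _,_; proj₁; proj₂)
open import Data.Sum using (_⊎_)
open import Data.Vec using (Vec; []; _∷_; lookup)
open import Data.List using (List; []; _∷_)
open import Data.List.Membership.Propositional using (_∈_)
open import Relation.Binary.PropositionalEquality using (_≡_; _≢_)
open import Relation.Nullary using (¬_)
open import Function.Definitions using (Surjective)
open import Function.Bundles using (_⇔_)

data Sign : Set where
  plus minus zer : Sign

neg : Sign → Sign
neg plus  = minus
neg minus = plus
neg zer   = zer

compose : Sign → Sign → Sign
compose zer   t = t
compose plus  _ = plus
compose minus _ = minus

Pair : ℕ → Set
Pair n = Σ (Fin n × Fin n) (λ p → proj₁ p < proj₂ p)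

SignVec : ℕ → Set
SignVec n = Pair n → Sign

zeroVec : ∀ {n} → SignVec n
zeroVec _ = zer

negVec : ∀ {n} → SignVec n → SignVec n
negVec X e = neg (X e)

_∘ᵥ_ : ∀ {n} → SignVec n → SignVec n → SignVec n
(X ∘ᵥ Y) e = compose (X e) (Y e)

Separates : ∀ {n} → SignVec n → SignVec n → Pair n → Set
Separates X Y e = (X e ≢ zer) × (X e ≡ neg (Y e))

-- The set of covectors is a predicate on sign vectors; since sign vectors
-- are functions, we require the predicate to respect pointwise equality
-- (i.e. it is a genuine set of sign vectors).

record OrientedMatroid (n : ℕ) : Set₁ where
  field
    Covector  : SignVec n → Set
    respects  : ∀ {X Y} → (∀ e → X e ≡ Y e) → Covector X → Covector Y
    cov-zero  : Covector zeroVec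
    cov-neg   : ∀ {X} → Covector X → Covector (negVec X)
    cov-comp  : ∀ {X Y} → Covector X → Covector Y → Covector (X ∘ᵥ Y)
    cov-elim  : ∀ {X Y} → Covector X → Covector Y → ∀ e → Separates X Y e →
                ∃[ Z ] (Covector Z × (Z e ≡ zer) ×
                        (∀ f → ¬ Separates X Y f → Z f ≡ (X ∘ᵥ Y) f))

open OrientedMatroid public

cmpSign : ∀ {m} → Fin m → Fin m → Sign
cmpSign zero    zero    = zer
cmpSign zero    (suc _) = plus
cmpSign (suc _) zero    = minus
cmpSign (suc a) (suc b) = cmpSign a b

-- An ordered partition of [n] into m (nonempty) blocks is given by its
-- block-index map p : Fin n → Fin m, which is surjective.
-- X^I_(i,j) = cmpSign (p i) (p j).
IsBraidCovector : ∀ {n} → SignVec n → Set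
IsBraidCovector {n} X =
  ∃[ m ] ∃[ p ] (Surjective {A = Fin n} {B = Fin m} _≡_ _≡_ p ×
                 (∀ (e : Pair n) → X e ≡ cmpSign (p (proj₁ (proj₁ e))) (p (proj₂ (proj₁ e)))))

IsSweep : ∀ {n} → OrientedMatroid n → Set
IsSweep M = ∀ X → Covector M X → IsBraidCovector X

Orthogonal : ∀ {k} → Vec Sign k → Vec Sign k → Set
Orthogonal {k} X Y =
  (∀ (e : Fin k) → (lookup X e ≡ zer) ⊎ (lookup Y e ≡ zer))
  ⊎ ( ¬ (∀ (e : Fin k) → lookup X e ≢ zer → lookup Y e ≢ zer → lookup X e ≡ lookup Y e)
    × ¬ (∀ (e : Fin k) → lookup X e ≢ zer → lookup Y e ≢ zer → lookup X e ≡ neg (lookup Y e)))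

triple : ∀ {n} → SignVec n → (i j k : Fin n) → i < j → j < k → Vec Sign 3
triple X i j k p q =
  X ((i , j) , p) ∷ X ((j , k) , q) ∷ X ((i , k) , <-trans p q) ∷ []

ppm : Vec Sign 3
ppm = plus ∷ plus ∷ minus ∷ []

forbidden : List (Vec Sign 3)
forbidden =
    (plus ∷ plus ∷ minus ∷ [])
  ∷ (minus ∷ minus ∷ plus ∷ [])
  ∷ (zer ∷ plus ∷ minus ∷ [])
  ∷ (zer ∷ minus ∷ plus ∷ [])
  ∷ (plus ∷ zer ∷ minus ∷ [])
  ∷ (minus ∷ zer ∷ plus ∷ [])
  ∷ (plus ∷ plus ∷ zer ∷ [])
  ∷ (minus ∷ minus ∷ zer ∷ [])
  ∷ (zer ∷ zer ∷ minus ∷ [])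
  ∷ (zer ∷ zer ∷ plus ∷ [])
  ∷ (zer ∷ plus ∷ zer ∷ [])
  ∷ (zer ∷ minus ∷ zer ∷ [])
  ∷ (plus ∷ zer ∷ zer ∷ [])
  ∷ (minus ∷ zer ∷ zer ∷ [])
  ∷ []

TriplesOrthogonal : ∀ {n} → OrientedMatroid n → Set
TriplesOrthogonal {n} M =
  ∀ X → Covector M X → ∀ (i j k : Fin n) (p : i < j) (q : j < k) →
  Orthogonal (triple X i j k p q) ppm

TriplesAvoid : ∀ {n} → OrientedMatroid n → Set
TriplesAvoid {n} M =
  ∀ X → Covector M X → ∀ (i j k : Fin n) (p : i < j) (q : j < k) →
  ¬ (triple X i j k p q ∈ forbidden)

-- A sign vector on pairs is a braid covector exactly when it records the comparisons of a weak
-- order on [n]. The triangle condition says that each triangle i < j < k is realised by a weak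
-- order on {i, j, k}; these are 13 of the 27 sign triples, namely those orthogonal to (+, +, -),
-- equivalently those outside the forbidden list. Conversely, extend X antisymmetrically to all
-- ordered pairs. Consistency of every triangle makes "X_(k,i) = +" propagate along + and 0, so
-- the number of k with X_(k,i) = + increases strictly along + and is constant along 0; X is the
-- comparison vector of these ranks, and discarding unused ranks yields an ordered partition.
module Submission where

open import Defs
open import Data.Nat using (ℕ)
open import Data.Product using (_×_)
open import Function.Bundles using (_⇔_)

open import Data.Nat using (zero; suc; s≤s)
open import Data.Fin using (Fin; zero; suc; fromℕ<; punchOut; _<_)
open import Data.Fin.Properties using (<-cmp; <-irrelevant; <-trans; all?; any?; ¬∀⟶∃¬; toℕ-fromℕ<)
open import Data.Fin.Subset using (Subset; _⊆_; _⊂_) renaming (_∈_ to _∈ₛ_)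
open import Data.Fin.Subset.Properties using (∣p∣≤n; p⊂q⇒∣p∣<∣q∣; ⊆-antisym)
open import Data.Product using (∃-syntax; _,_; proj₁; proj₂)
open import Data.Sum using (_⊎_; inj₁; inj₂)
open import Data.Empty using (⊥-elim)
open import Data.Vec using (Vec; []; _∷_; lookup; tabulate)
open import Data.Vec.Properties using (≡-dec; lookup∘tabulate; []=⇒lookup; lookup⇒[]=)
open import Data.List.Membership.Propositional using (_∈_)
open import Relation.Binary.PropositionalEquality
open import Relation.Binary.Definitions using (DecidableEquality; tri<; tri≈; tri>)
open import Relation.Nullary using (Dec; yes; no; ¬_; does; proof; ¬?; _×-dec_; _⊎-dec_; _→-dec_)
open import Relation.Nullary.Decidable using (from-yes; map′; dec-true)
open import Relation.Nullary.Reflects using (Reflects; invert)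
open import Function.Base using (_∘_; id)
open import Function.Bundles using (mk⇔; Equivalence)
open import Function.Definitions using (Surjective)
open import Function.Properties.Equivalence using () renaming (trans to ⇔-trans)

_≟_ : DecidableEquality Sign
plus  ≟ plus  = yes refl
minus ≟ minus = yes refl
zer   ≟ zer   = yes refl
plus  ≟ minus = no λ ()
plus  ≟ zer   = no λ ()
minus ≟ plus  = no λ ()
minus ≟ zer   = no λ ()
zer   ≟ plus  = no λ ()
zer   ≟ minus = no λ ()

open import Data.List.Membership.DecPropositional (≡-dec {n = 3} _≟_) using (_∈?_)

neg-involutive : ∀ s → neg (neg s) ≡ s
neg-involutive plus  = refl
neg-involutive minus = refl
neg-involutive zer   = refl

neg-fixed⇒zer : ∀ {s} → s ≡ neg s → s ≡ zer
neg-fixed⇒zer {plus}  ()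
neg-fixed⇒zer {minus} ()
neg-fixed⇒zer {zer}   _ = refl

∀-Sign? : {P : Sign → Set} → (∀ s → Dec (P s)) → Dec (∀ s → P s)
∀-Sign? P? = map′ (λ (p , m , z) → λ { plus → p ; minus → m ; zer → z })
                  (λ ∀P → ∀P plus , ∀P minus , ∀P zer)
                  (P? plus ×-dec P? minus ×-dec P? zer)

∀-Sign³? : {P : Sign → Sign → Sign → Set} →
           (∀ x y z → Dec (P x y z)) → Dec (∀ x y z → P x y z)
∀-Sign³? P? = ∀-Sign? λ x → ∀-Sign? λ y → ∀-Sign? (P? x y)

_⇔?_ : {A B : Set} → Dec A → Dec B → Dec (A ⇔ B)
a? ⇔? b? = map′ (λ (f , g) → mk⇔ f g) (λ e → Equivalence.to e , Equivalence.from e)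
                ((a? →-dec b?) ×-dec (b? →-dec a?))

-- The sign triples (X_(i,j), X_(j,k), X_(i,k)) realised by weak orders on {i, j, k}: when the
-- steps i → j and j → k point in opposite directions the sign of i → k is free, otherwise it
-- is their composition.
Consistent : Sign → Sign → Sign → Set
Consistent x y z = (x ≢ zer × x ≡ neg y) ⊎ z ≡ compose x y

consistent? : ∀ x y z → Dec (Consistent x y z)
consistent? x y z = (¬? (x ≟ zer) ×-dec (x ≟ neg y)) ⊎-dec (z ≟ compose x y)

ConsistentTriple : Vec Sign 3 → Set
ConsistentTriple (x ∷ y ∷ z ∷ []) = Consistent x y z

consistent-swap₁₂ : ∀ x y z → Consistent x y z → Consistent (neg x) z y
consistent-swap₁₂ = from-yes (∀-Sign³? λ x y z → consistent? x y z →-dec consistent? (neg x) z y)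

consistent-swap₂₃ : ∀ x y z → Consistent x y z → Consistent z (neg y) x
consistent-swap₂₃ = from-yes (∀-Sign³? λ x y z → consistent? x y z →-dec consistent? z (neg y) x)

consistent-plus : ∀ x y z → Consistent x y z → x ≡ plus → y ≢ minus → z ≡ plus
consistent-plus = from-yes (∀-Sign³? λ x y z →
  consistent? x y z →-dec (x ≟ plus →-dec (¬? (y ≟ minus) →-dec z ≟ plus)))

consistent-zer-middle : ∀ x → Consistent x zer x
consistent-zer-middle = from-yes (∀-Sign? λ x → consistent? x zer x)

consistent-opposite : ∀ x → Consistent x (neg x) zer
consistent-opposite = from-yes (∀-Sign? λ x → consistent? x (neg x) zer)

consistent-to-minus : ∀ x → Consistent x minus minus
consistent-to-minus = from-yes (∀-Sign? λ x → consistent? x minus minus)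

orthogonal? : ∀ {k} (X Y : Vec Sign k) → Dec (Orthogonal X Y)
orthogonal? X Y =
  all? (λ e → (lookup X e ≟ zer) ⊎-dec (lookup Y e ≟ zer))
  ⊎-dec (¬? (conform? id) ×-dec ¬? (conform? neg))
  where
  conform? : (f : Sign → Sign) →
             Dec (∀ e → lookup X e ≢ zer → lookup Y e ≢ zer → lookup X e ≡ f (lookup Y e))
  conform? f = all? λ e →
    ¬? (lookup X e ≟ zer) →-dec (¬? (lookup Y e ≟ zer) →-dec (lookup X e ≟ f (lookup Y e)))

consistent⇔orthogonal : ∀ t → ConsistentTriple t ⇔ Orthogonal t ppm
consistent⇔orthogonal (x ∷ y ∷ z ∷ []) = decided x y z
  where
  decided : ∀ x y z → Consistent x y z ⇔ Orthogonal (x ∷ y ∷ z ∷ []) ppm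
  decided = from-yes (∀-Sign³? λ x y z → consistent? x y z ⇔? orthogonal? (x ∷ y ∷ z ∷ []) ppm)

consistent⇔allowed : ∀ t → ConsistentTriple t ⇔ (¬ t ∈ forbidden)
consistent⇔allowed (x ∷ y ∷ z ∷ []) = decided x y z
  where
  decided : ∀ x y z → Consistent x y z ⇔ (¬ (x ∷ y ∷ z ∷ []) ∈ forbidden)
  decided = from-yes (∀-Sign³? λ x y z → consistent? x y z ⇔? ¬? ((x ∷ y ∷ z ∷ []) ∈? forbidden))

cmpSign-< : ∀ {m} {a b : Fin m} → a < b → cmpSign a b ≡ plus
cmpSign-< {a = zero}  {zero}  ()
cmpSign-< {a = zero}  {suc b} _ = refl
cmpSign-< {a = suc a} {zero}  ()
cmpSign-< {a = suc a} {suc b} (s≤s a<b) = cmpSign-< a<b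

cmpSign-refl : ∀ {m} (a : Fin m) → cmpSign a a ≡ zer
cmpSign-refl zero    = refl
cmpSign-refl (suc a) = cmpSign-refl a

cmpSign-antisym : ∀ {m} (a b : Fin m) → cmpSign b a ≡ neg (cmpSign a b)
cmpSign-antisym zero    zero    = refl
cmpSign-antisym zero    (suc b) = refl
cmpSign-antisym (suc a) zero    = refl
cmpSign-antisym (suc a) (suc b) = cmpSign-antisym a b

consistent-cmpSign : ∀ {m} (a b c : Fin m) →
                     Consistent (cmpSign a b) (cmpSign b c) (cmpSign a c)
consistent-cmpSign zero    zero    zero    = inj₂ refl
consistent-cmpSign zero    zero    (suc c) = inj₂ refl
consistent-cmpSign zero    (suc b) zero    = inj₁ ((λ ()) , refl)
consistent-cmpSign zero    (suc b) (suc c) = inj₂ refl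
consistent-cmpSign (suc a) zero    zero    = inj₂ refl
consistent-cmpSign (suc a) zero    (suc c) = inj₁ ((λ ()) , refl)
consistent-cmpSign (suc a) (suc b) zero    = consistent-to-minus (cmpSign a b)
consistent-cmpSign (suc a) (suc b) (suc c) = consistent-cmpSign a b c

cmpSign-punchOut : ∀ {m} (v a b : Fin (suc m)) (v≢a : v ≢ a) (v≢b : v ≢ b) →
                   cmpSign (punchOut v≢a) (punchOut v≢b) ≡ cmpSign a b
cmpSign-punchOut zero zero _ v≢a _ = ⊥-elim (v≢a refl)
cmpSign-punchOut zero (suc a) zero _ v≢b = ⊥-elim (v≢b refl)
cmpSign-punchOut zero (suc a) (suc b) _ _ = refl
cmpSign-punchOut {suc m} (suc v) zero    zero    _ _ = refl
cmpSign-punchOut {suc m} (suc v) zero    (suc b) _ _ = refl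
cmpSign-punchOut {suc m} (suc v) (suc a) zero    _ _ = refl
cmpSign-punchOut {suc m} (suc v) (suc a) (suc b) v≢a v≢b =
  cmpSign-punchOut v a b (v≢a ∘ cong suc) (v≢b ∘ cong suc)

OrderedPartitionOf : ∀ {n m} → (Fin n → Fin m) → Set
OrderedPartitionOf {n} h =
  ∃[ m′ ] ∃[ p ] (Surjective {A = Fin n} {B = Fin m′} _≡_ _≡_ p ×
                  (∀ i j → cmpSign (p i) (p j) ≡ cmpSign (h i) (h j)))

inImage? : ∀ {n m} (h : Fin n → Fin m) v → Dec (∃[ i ] h i ≡ v)
inImage? h v = any? λ i → h i Data.Fin.≟ v

-- Values missed by h are punched out one at a time, which preserves all comparisons.
orderedPartition : ∀ {n} m (h : Fin n → Fin m) → OrderedPartitionOf h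
orderedPartition zero h = zero , h , (λ ()) , λ _ _ → refl
orderedPartition (suc m) h with all? (inImage? h)
... | yes hits = suc m , h , surjective , λ _ _ → refl
  where
  surjective : Surjective _≡_ _≡_ h
  surjective v = proj₁ (hits v) , λ { refl → proj₂ (hits v) }
... | no ¬hits with ¬∀⟶∃¬ (suc m) _ (inImage? h) ¬hits
...   | v , missed
  with orderedPartition m (λ i → punchOut {i = v} {j = h i} λ v≡hi → missed (i , sym v≡hi))
...   | m′ , p , surjective , cmp =
  m′ , p , surjective , λ i j → trans (cmp i j) (cmpSign-punchOut v (h i) (h j) _ _)

module Orientation {n : ℕ} (S : Fin n → Fin n → Sign)
                   (S-antisym : ∀ a b → S b a ≡ neg (S a b)) where

  S-refl : ∀ a → S a a ≡ zer
  S-refl a = neg-fixed⇒zer (S-antisym a a)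

  Triangle : Fin n → Fin n → Fin n → Set
  Triangle a b c = Consistent (S a b) (S b c) (S a c)

  triangle-swap₁₂ : ∀ {a b c} → Triangle a b c → Triangle b a c
  triangle-swap₁₂ {a} {b} {c} t =
    subst (λ s → Consistent s (S a c) (S b c)) (sym (S-antisym a b)) (consistent-swap₁₂ _ _ _ t)

  triangle-swap₂₃ : ∀ {a b c} → Triangle a b c → Triangle a c b
  triangle-swap₂₃ {a} {b} {c} t =
    subst (λ s → Consistent (S a c) s (S a b)) (sym (S-antisym b c)) (consistent-swap₂₃ _ _ _ t)

  triangle-≡₁₂ : ∀ {a c} → Triangle a a c
  triangle-≡₁₂ {a} {c} = subst (λ s → Consistent s (S a c) (S a c)) (sym (S-refl a)) (inj₂ refl)

  triangle-≡₂₃ : ∀ {a b} → Triangle a b b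
  triangle-≡₂₃ {a} {b} =
    subst (λ s → Consistent (S a b) s (S a b)) (sym (S-refl b)) (consistent-zer-middle (S a b))

  triangle-≡₁₃ : ∀ {a b} → Triangle a b a
  triangle-≡₁₃ {a} {b} = subst₂ (Consistent (S a b)) (sym (S-antisym a b)) (sym (S-refl a))
                                (consistent-opposite (S a b))

  module _ (increasing : ∀ {a b c} → a < b → b < c → Triangle a b c) where

    triangle-< : ∀ {a b} c → a < b → Triangle a b c
    triangle-< {a} {b} c a<b with <-cmp b c
    ... | tri< b<c _ _  = increasing a<b b<c
    ... | tri≈ _ refl _ = triangle-≡₂₃
    ... | tri> _ _ c<b with <-cmp a c
    ...   | tri< a<c _ _  = triangle-swap₂₃ (increasing a<c c<b)
    ...   | tri≈ _ refl _ = triangle-≡₁₃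
    ...   | tri> _ _ c<a  = triangle-swap₂₃ (triangle-swap₁₂ (increasing c<a a<b))

    triangle : ∀ a b c → Triangle a b c
    triangle a b c with <-cmp a b
    ... | tri< a<b _ _  = triangle-< c a<b
    ... | tri≈ _ refl _ = triangle-≡₁₂
    ... | tri> _ _ b<a  = triangle-swap₁₂ (triangle-< c b<a)

  module _ (triangles : ∀ a b c → Triangle a b c) where

    below : Fin n → Subset n
    below j = tabulate λ k → does (S k j ≟ plus)

    below⁺ : ∀ {k j} → S k j ≡ plus → k ∈ₛ below j
    below⁺ {k} {j} Skj =
      lookup⇒[]= k (below j) (trans (lookup∘tabulate _ k) (dec-true (S k j ≟ plus) Skj))

    below⁻ : ∀ {k j} → k ∈ₛ below j → S k j ≡ plus
    below⁻ {k} {j} k∈ =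
      invert (subst (Reflects _) (trans (sym (lookup∘tabulate _ k)) ([]=⇒lookup k∈))
                    (proof (S k j ≟ plus)))

    -- Consistency of the triangle (k, i, j) propagates S k i = + to S k j.
    below-⊆ : ∀ {i j} → S i j ≢ minus → below i ⊆ below j
    below-⊆ {i} {j} Sij≢- {k} k∈ =
      below⁺ (consistent-plus _ _ _ (triangles k i j) (below⁻ k∈) Sij≢-)

    below-⊂ : ∀ {i j} → S i j ≡ plus → below i ⊂ below j
    below-⊂ {i} {j} Sij = below-⊆ (λ Sij≡- → plus≢minus (trans (sym Sij) Sij≡-))
                        , i , below⁺ Sij , λ i∈ → zer≢plus (trans (sym (S-refl i)) (below⁻ i∈))
      where
      plus≢minus : plus ≢ minus
      plus≢minus ()
      zer≢plus : zer ≢ plus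
      zer≢plus ()

    rank : Subset n → Fin (suc n)
    rank p = fromℕ< (s≤s (∣p∣≤n p))

    level : Fin n → Fin (suc n)
    level i = rank (below i)

    level-< : ∀ {i j} → S i j ≡ plus → level i < level j
    level-< {i} {j} Sij = subst₂ Data.Nat._<_ (sym (toℕ-fromℕ< _)) (sym (toℕ-fromℕ< _))
                                 (p⊂q⇒∣p∣<∣q∣ (below-⊂ Sij))

    level-≡ : ∀ {i j} → S i j ≡ zer → level i ≡ level j
    level-≡ {i} {j} Sij = cong rank (⊆-antisym (below-⊆ (zer≢minus Sij)) (below-⊆ (zer≢minus Sji)))
      where
      Sji : S j i ≡ zer
      Sji = trans (S-antisym i j) (cong neg Sij)
      zer≢minus : ∀ {s} → s ≡ zer → s ≢ minus
      zer≢minus refl ()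

    S≡cmpSign-level : ∀ i j → S i j ≡ cmpSign (level i) (level j)
    S≡cmpSign-level i j with S i j in Sij
    ... | plus  = sym (cmpSign-< (level-< Sij))
    ... | minus = sym (trans (cmpSign-antisym (level j) (level i))
                             (cong neg (cmpSign-< (level-< (trans (S-antisym i j) (cong neg Sij))))))
    ... | zer   = sym (trans (cong (cmpSign (level i)) (sym (level-≡ Sij))) (cmpSign-refl (level i)))

AllTriplesConsistent : ∀ {n} → SignVec n → Set
AllTriplesConsistent {n} X =
  ∀ (i j k : Fin n) (p : i < j) (q : j < k) → ConsistentTriple (triple X i j k p q)

orient : ∀ {n} → SignVec n → Fin n → Fin n → Sign
orient X a b with <-cmp a b
... | tri< a<b _ _ = X ((a , b) , a<b)
... | tri≈ _ _ _   = zer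
... | tri> _ _ b<a = neg (X ((b , a) , b<a))

module _ {n} (X : SignVec n) where

  orient-< : ∀ {a b} (a<b : a < b) → orient X a b ≡ X ((a , b) , a<b)
  orient-< {a} {b} a<b with <-cmp a b
  ... | tri< a<b′ _ _ = cong (λ p → X ((a , b) , p)) (<-irrelevant a<b′ a<b)
  ... | tri≈ ¬a<b _ _ = ⊥-elim (¬a<b a<b)
  ... | tri> ¬a<b _ _ = ⊥-elim (¬a<b a<b)

  orient-> : ∀ {a b} (b<a : b < a) → orient X a b ≡ neg (X ((b , a) , b<a))
  orient-> {a} {b} b<a with <-cmp a b
  ... | tri< _ _ ¬b<a = ⊥-elim (¬b<a b<a)
  ... | tri≈ _ _ ¬b<a = ⊥-elim (¬b<a b<a)
  ... | tri> _ _ b<a′ = cong (λ p → neg (X ((b , a) , p))) (<-irrelevant b<a′ b<a)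

  orient-refl : ∀ a → orient X a a ≡ zer
  orient-refl a with <-cmp a a
  ... | tri< _ a≢a _ = ⊥-elim (a≢a refl)
  ... | tri≈ _ _ _   = refl
  ... | tri> _ a≢a _ = ⊥-elim (a≢a refl)

  orient-antisym : ∀ a b → orient X b a ≡ neg (orient X a b)
  orient-antisym a b with <-cmp a b
  ... | tri< a<b _ _  = orient-> a<b
  ... | tri≈ _ refl _ = orient-refl a
  ... | tri> _ _ b<a  = trans (orient-< b<a) (sym (neg-involutive _))

  orient-consistent : AllTriplesConsistent X → ∀ {a b c} → a < b → b < c →
                      Consistent (orient X a b) (orient X b c) (orient X a c)
  orient-consistent consistent {a} {b} {c} a<b b<c
    rewrite orient-< a<b | orient-< b<c | orient-< (<-trans a<b b<c) = consistent a b c a<b b<c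

braid⇒consistent : ∀ {n} {X : SignVec n} → IsBraidCovector X → AllTriplesConsistent X
braid⇒consistent (_ , f , _ , X≡) i j k p q
  rewrite X≡ ((i , j) , p) | X≡ ((j , k) , q) | X≡ ((i , k) , <-trans p q) =
  consistent-cmpSign (f i) (f j) (f k)

consistent⇒braid : ∀ {n} (X : SignVec n) → AllTriplesConsistent X → IsBraidCovector X
consistent⇒braid {n} X consistent = fromPartition (orderedPartition (suc n) (level triangles))
  where
  open Orientation (orient X) (orient-antisym X)

  triangles : ∀ a b c → Triangle a b c
  triangles = triangle (orient-consistent X consistent)

  fromPartition : OrderedPartitionOf (level triangles) → IsBraidCovector X
  fromPartition (m , p , surjective , cmp) = m , p , surjective , λ { ((i , j) , i<j) →
    trans (sym (orient-< X i<j)) (trans (S≡cmpSign-level triangles i j) (sym (cmp i j))) }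

TriplesSatisfy : ∀ {n} → (Vec Sign 3 → Set) → OrientedMatroid n → Set
TriplesSatisfy {n} P M =
  ∀ X → Covector M X → ∀ (i j k : Fin n) (p : i < j) (q : j < k) → P (triple X i j k p q)

triplesSatisfy-cong : ∀ {n} (M : OrientedMatroid n) {P Q : Vec Sign 3 → Set} →
                      (∀ t → P t ⇔ Q t) → TriplesSatisfy P M ⇔ TriplesSatisfy Q M
triplesSatisfy-cong M P⇔Q = mk⇔
  (λ P-all X X∈ i j k p q → Equivalence.to   (P⇔Q _) (P-all X X∈ i j k p q))
  (λ Q-all X X∈ i j k p q → Equivalence.from (P⇔Q _) (Q-all X X∈ i j k p q))

sweep⇔consistent : ∀ {n} (M : OrientedMatroid n) → IsSweep M ⇔ TriplesSatisfy ConsistentTriple M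
sweep⇔consistent M = mk⇔ (λ sweep X X∈ → braid⇒consistent (sweep X X∈))
                       (λ consistent X X∈ → consistent⇒braid X (consistent X X∈))

lemma3p8 : (n : ℕ) (M : OrientedMatroid n) →
    (IsSweep M ⇔ TriplesOrthogonal M) × (IsSweep M ⇔ TriplesAvoid M)
lemma3p8 n M = ⇔-trans (sweep⇔consistent M) (triplesSatisfy-cong M consistent⇔orthogonal)
             , ⇔-trans (sweep⇔consistent M) (triplesSatisfy-cong M consistent⇔allowed)
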